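{- Given $r,\ell\in\mathbb{N}$ and positive constants $\varepsilon,\alpha$, there exists $n_0$ such that for all integers $n,n'$ with $n>n'\ge n_0$, $$\frac{1}{n'}\mathbf{RT}^*_\ell(n',K_r,\alpha n')-\varepsilon\le\frac1n\mathbf{RT}^*_\ell(n,K_r,2\alpha n).$$
   Context: For a graph $G$, $\alpha_\ell(G)$ is the maximum number of vertices of an induced subgraph containing no copy of $K_\ell$. For $\alpha>0$, $\mathbf{RT}^*_\ell(n,K_r,\alpha n)$ denotes the minimum integer $\delta$ such that every $n$-vertex graph $G$ with minimum degree $\delta(G)\ge\delta$ and $\alpha_\ell(G)\le\alpha n$ contains a copy of $K_r$.
   Formalization: The constants ε and α range over the positive rationals. -}

module Defs where

open import Data.Nat using (ℕ; zero; suc; _≤_)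
open import Data.Bool using (Bool; true; false)
open import Data.Fin using (Fin)
open import Data.Fin.Subset using (Subset; _∈_; ∣_∣)
open import Data.Vec using (tabulate)
open import Data.Integer using (+_)
open import Data.Product using (Σ; _×_)
open import Relation.Binary.PropositionalEquality using (_≡_; _≢_)
open import Relation.Nullary using (¬_)
import Data.Rational as ℚ
open ℚ using (ℚ)

record Graph (n : ℕ) : Set where
  field
    adj   : Fin n → Fin n → Bool
    sym   : ∀ u v → adj u v ≡ adj v u
    irrefl : ∀ v → adj v v ≡ false
open Graph public

degree : ∀ {n} → Graph n → Fin n → ℕ
degree G u = ∣ tabulate (adj G u) ∣

MinDegree≥ : ∀ {n} → Graph n → ℕ → Set
MinDegree≥ G d = ∀ v → d ≤ degree G v

CliqueIn : ∀ {n} → Graph n → ℕ → Subset n → Set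
CliqueIn {n} G r S =
  Σ (Fin r → Fin n) λ f →
    (∀ i → f i ∈ S) × (∀ i j → i ≢ j → adj G (f i) (f j) ≡ true)

HasClique : ∀ {n} → Graph n → ℕ → Set
HasClique G r = CliqueIn G r Data.Fin.Subset.⊤

ℕ→ℚ : ℕ → ℚ
ℕ→ℚ m = (+ m) ℚ./ 1

αℓ≤ : ∀ {n} → ℕ → Graph n → ℚ → Set
αℓ≤ ℓ G x = ∀ S → ¬ CliqueIn G ℓ S → ℕ→ℚ ∣ S ∣ ℚ.≤ x

RTProp : (ℓ n r : ℕ) (α : ℚ) (δ : ℕ) → Set
RTProp ℓ n r α δ =
  (G : Graph n) → MinDegree≥ G δ → αℓ≤ ℓ G (α ℚ.* ℕ→ℚ n) → HasClique G r

IsRT* : (ℓ n r : ℕ) (α : ℚ) (δ : ℕ) → Set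
IsRT* ℓ n r α δ = RTProp ℓ n r α δ × (∀ δ' → RTProp ℓ n r α δ' → δ ≤ δ')

-- a / m as a rational (m > 0 in all uses; 0 if m = 0)
frac : ℕ → ℕ → ℚ
frac a zero = ℚ.0ℚ
frac a (suc m) = (+ a) ℚ./ suc m

{-# OPTIONS --safe #-}
-- Let G have N vertices, minimum degree D and α_ℓ(G) ≤ αN, and write n = qN + s with
-- s < N. Replacing every vertex of G by q independent copies, plus one more copy for
-- each vertex of an s-set T, gives an n-vertex graph H whose cliques project to
-- cliques of G and whose K_ℓ-free sets lie over K_ℓ-free sets of G; so H has no K_r
-- if G has none, and α_ℓ(H) ≤ (q + 1)αN ≤ 2αn. A copy of u has degree
-- q·d(u) + |N(u) ∩ T|, which is at least (n/N)·D − 2N/k as soon as T meets every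
-- neighbourhood A in at least (s/N)|A| − 2N/k points. Such a T is built point by
-- point, each point going to the side that makes the first-order change of the
-- potential Σ_A (N|A ∩ T| − s|A|)⁴ non-positive; the potential then stays below
-- 16(N + 1)³N⁴, which for N ≥ 128k⁴ bounds every deviation by N²/k (a derandomised
-- fourth-moment method). Hence RT*(N, αN) ≤ (N/n)·RT*(n, 2αn) + 4N/k, and taking for
-- k four times the denominator of ε gives the claim.
module Submission where

module IntegerLemmas where

  open import Data.Nat as ℕ using (zero; suc)
  open import Data.Integer hiding (suc)
  open import Data.Integer.Properties
  open import Data.Integer.Tactic.RingSolver using (solve-∀)
  open import Relation.Binary.PropositionalEquality

  pos-^ : ∀ m n → + (m ℕ.^ n) ≡ (+ m) ^ n
  pos-^ m zero    = refl
  pos-^ m (suc n) = trans (pos-* m (m ℕ.^ n)) (cong (+ m *_) (pos-^ m n))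

  i^4≡+∣i∣^4 : ∀ i → i ^ 4 ≡ + (∣ i ∣ ℕ.^ 4)
  i^4≡+∣i∣^4 (+ n)    = sym (pos-^ n 4)
  i^4≡+∣i∣^4 -[1+ n ] = trans (neg-even (+ suc n)) (sym (pos-^ (suc n) 4))
    where
    -- The ring solver does not accept _^_, so here and below powers are written out.
    neg-even : ∀ i → (- i) * ((- i) * ((- i) * ((- i) * 1ℤ))) ≡ i * (i * (i * (i * 1ℤ)))
    neg-even = solve-∀

  0≤i^4 : ∀ i → 0ℤ ≤ i ^ 4
  0≤i^4 i = subst (0ℤ ≤_) (sym (i^4≡+∣i∣^4 i)) (+≤+ ℕ.z≤n)

  0≤i*i : ∀ i → 0ℤ ≤ i * i
  0≤i*i (+ n)    = subst (0ℤ ≤_) (pos-* n n) (+≤+ ℕ.z≤n)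
  0≤i*i -[1+ n ] = +≤+ ℕ.z≤n

  0≤i*j : ∀ {i j} → 0ℤ ≤ i → 0ℤ ≤ j → 0ℤ ≤ i * j
  0≤i*j {i} {j} 0≤i 0≤j =
    subst (_≤ i * j) (*-zeroʳ i) (*-monoˡ-≤-nonNeg i {{nonNegative 0≤i}} 0≤j)

  ≤-by-slack : ∀ {i j} k → 0ℤ ≤ k → i + k ≡ j → i ≤ j
  ≤-by-slack {i} k 0≤k refl = i≤i+j i k {{nonNegative 0≤k}}

module FourthMomentGreedy where

  open import Data.Nat as ℕ using (ℕ; zero; suc)
  import Data.Nat.Properties as ℕP
  open import Data.Integer hiding (suc)
  open import Data.Integer.Properties
  open import Data.Integer.Tactic.RingSolver using (solve-∀)
  open import Data.Fin.Subset using (Subset; Side; inside; outside)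
  open import Data.Vec using ([]; _∷_)
  open import Data.List using (List; []; _∷_; length; map; foldr)
  import Data.List.Properties as List
  open import Data.List.Relation.Unary.All using (All; []; _∷_)
  import Data.List.Relation.Unary.All as All
  import Data.List.Relation.Unary.All.Properties as All
  open import Data.Product using (Σ; _×_; _,_; proj₁)
  open import Function using (_∘_)
  open import Relation.Binary.PropositionalEquality
  open import Relation.Nullary using (yes; no)
  open IntegerLemmas

  -- Opaque: unfolding the ring-solver proof makes checking the functions defined
  -- by several clauses that use this lemma extremely slow.
  opaque
    quartic-step : ∀ u D x → 0ℤ ≤ u →
      u * (D + x) ^ 4 ≤ (1ℤ + u) * D ^ 4 + + 4 * u * x * D ^ 3 + u * (+ 16 * u + + 3) * x ^ 4
    quartic-step u D x 0≤u = ≤-by-slack (Y * Y + + 2 * u * (Z * Z))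
      (+-mono-≤ (0≤i*i Y) (0≤i*j (0≤i*j {+ 2} (+≤+ ℕ.z≤n) 0≤u) (0≤i*i Z)))
      (expansion u D x)
      where
      Y Z : ℤ
      Y = D * D - + 4 * u * (x * x)
      Z = x * (D - x)
      expansion : ∀ u D x →
        u * ((D + x) * ((D + x) * ((D + x) * ((D + x) * 1ℤ))))
          + ((D * D - + 4 * u * (x * x)) * (D * D - + 4 * u * (x * x)) + + 2 * u * ((x * (D - x)) * (x * (D - x))))
        ≡ (1ℤ + u) * (D * (D * (D * (D * 1ℤ)))) + + 4 * u * x * (D * (D * (D * 1ℤ)))
          + u * (+ 16 * u + + 3) * (x * (x * (x * (x * 1ℤ))))
      expansion = solve-∀

  signedSum : ∀ {L} → (Side → ℤ) → Subset L → Subset L → ℤ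
  signedSum w []            []      = 0ℤ
  signedSum w (inside ∷ A)  (t ∷ T) = w t + signedSum w A T
  signedSum w (outside ∷ A) (_ ∷ T) = signedSum w A T

  quarticSum : List ℤ → ℤ
  quarticSum = foldr (λ x s → x ^ 4 + s) 0ℤ

  quarticSum-≤⇒All : ∀ xs {b} → quarticSum xs ≤ b → All (λ x → x ^ 4 ≤ b) xs
  quarticSum-≤⇒All []       _ = []
  quarticSum-≤⇒All (x ∷ xs) h =
    ≤-trans (i≤i+j (x ^ 4) (quarticSum xs) {{nonNegative (quarticSum-nonNeg xs)}}) h
      ∷ quarticSum-≤⇒All xs (≤-trans (i≤j+i (quarticSum xs) (x ^ 4) {{nonNegative (0≤i^4 x)}}) h)
    where
    quarticSum-nonNeg : ∀ xs → 0ℤ ≤ quarticSum xs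
    quarticSum-nonNeg []       = ≤-refl
    quarticSum-nonNeg (x ∷ xs) = +-mono-≤ (0≤i^4 x) (quarticSum-nonNeg xs)

  -- In a row (D , A), D is the part of a signed sum already fixed and A the part of
  -- the set whose points are still to be decided.
  Row : ℕ → Set
  Row L = ℤ × Subset L

  potential : ∀ {L} → List (Row L) → ℤ
  potential = quarticSum ∘ map proj₁

  advanceRow : ∀ {L} → ℤ → Row (suc L) → Row L
  advanceRow a (D , inside ∷ A)  = D + a , A
  advanceRow a (D , outside ∷ A) = D , A

  advance : ∀ {L} → ℤ → List (Row (suc L)) → List (Row L)
  advance a = map (advanceRow a)

  cubicWeight : ∀ {L} → Row (suc L) → ℤ
  cubicWeight (D , inside ∷ _)  = D ^ 3
  cubicWeight (D , outside ∷ _) = 0ℤ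

  cubicMass : ∀ {L} → List (Row (suc L)) → ℤ
  cubicMass = foldr (λ r s → cubicWeight r + s) 0ℤ

  advanceRow-≤ : ∀ {L} u a (r : Row (suc L)) → 0ℤ ≤ u →
    u * proj₁ (advanceRow a r) ^ 4
      ≤ (1ℤ + u) * proj₁ r ^ 4 + + 4 * u * a * cubicWeight r + u * (+ 16 * u + + 3) * a ^ 4
  advanceRow-≤ u a (D , inside ∷ A)  0≤u = quartic-step u D a 0≤u
  advanceRow-≤ u a (D , outside ∷ A) 0≤u =
    ≤-by-slack (D ^ 4 + u * (+ 16 * u + + 3) * a ^ 4)
      (+-mono-≤ (0≤i^4 D) (0≤i*j (0≤i*j 0≤u (+-mono-≤ (0≤i*j {+ 16} (+≤+ ℕ.z≤n) 0≤u) (+≤+ ℕ.z≤n))) (0≤i^4 a)))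
      (rearrange u a (D ^ 4) (u * (+ 16 * u + + 3)) (a ^ 4))
    where
    rearrange : ∀ u a P c Q → u * P + (P + c * Q) ≡ (1ℤ + u) * P + + 4 * u * a * 0ℤ + c * Q
    rearrange = solve-∀

  advance-≤ : ∀ {L} u a (rows : List (Row (suc L))) → 0ℤ ≤ u →
    u * potential (advance a rows)
      ≤ (1ℤ + u) * potential rows + + 4 * u * a * cubicMass rows
        + + length rows * (u * (+ 16 * u + + 3) * a ^ 4)
  advance-≤ u a []         _   = ≤-reflexive (zeros u a (u * (+ 16 * u + + 3) * a ^ 4))
    where
    zeros : ∀ u a K → u * 0ℤ ≡ (1ℤ + u) * 0ℤ + + 4 * u * a * 0ℤ + 0ℤ * K
    zeros = solve-∀
  advance-≤ u a (r ∷ rows) 0≤u = begin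
    u * (P′ + Φ′)                                  ≡⟨ *-distribˡ-+ u P′ Φ′ ⟩
    u * P′ + u * Φ′                                ≤⟨ +-mono-≤ (advanceRow-≤ u a r 0≤u) (advance-≤ u a rows 0≤u) ⟩
    ((1ℤ + u) * P + + 4 * u * a * c + K)
      + ((1ℤ + u) * Φ + + 4 * u * a * C + m * K)   ≡⟨ regroup u a P Φ c C K m ⟩
    (1ℤ + u) * (P + Φ) + + 4 * u * a * (c + C) + (1ℤ + m) * K ∎
    where
    open ≤-Reasoning
    P′ = proj₁ (advanceRow a r) ^ 4
    Φ′ = potential (advance a rows)
    P  = proj₁ r ^ 4
    Φ  = potential rows
    c  = cubicWeight r
    C  = cubicMass rows
    K  = u * (+ 16 * u + + 3) * a ^ 4
    m  = + length rows
    regroup : ∀ u a P Φ c C K m →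
      ((1ℤ + u) * P + + 4 * u * a * c + K) + ((1ℤ + u) * Φ + + 4 * u * a * C + m * K)
        ≡ (1ℤ + u) * (P + Φ) + + 4 * u * a * (c + C) + (1ℤ + m) * K
    regroup = solve-∀

  module _ (w : Side → ℤ) (w-outside≤0 : w outside ≤ 0ℤ) (0≤w-inside : 0ℤ ≤ w inside)
           (M : ℕ) (∣w∣≤M : ∀ b → ∣ w b ∣ ℕ.≤ M) where

    choose : ℤ → Side
    choose S with 0ℤ ≤? S
    ... | yes _ = outside
    ... | no  _ = inside

    w-choose-≤0 : ∀ S → w (choose S) * S ≤ 0ℤ
    w-choose-≤0 S with 0ℤ ≤? S
    ... | yes 0≤S = *-monoʳ-≤-nonNeg S {{nonNegative 0≤S}} w-outside≤0
    ... | no  S≱0 = subst (w inside * S ≤_) (*-zeroʳ (w inside))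
      (*-monoˡ-≤-nonNeg (w inside) {{nonNegative 0≤w-inside}} (<⇒≤ (≰⇒> S≱0)))

    nextSide : ∀ {L} → List (Row (suc L)) → Side
    nextSide rows = choose (cubicMass rows)

    greedy : ∀ {L} → List (Row L) → Subset L
    greedy {zero}  _    = []
    greedy {suc L} rows = b ∷ greedy (advance (w b) rows)
      where b = nextSide rows

    w^4≤M^4 : ∀ b → w b ^ 4 ≤ + (M ℕ.^ 4)
    w^4≤M^4 b = subst (_≤ + (M ℕ.^ 4)) (sym (i^4≡+∣i∣^4 (w b))) (+≤+ (ℕP.^-monoˡ-≤ 4 (∣w∣≤M b)))

    bound : ℕ → ℕ → ℤ
    bound m t = + 16 * + m * + (M ℕ.^ 4) * (+ suc t * + suc t)

    bound≡ : ∀ m t → bound m t ≡ + (16 ℕ.* m ℕ.* M ℕ.^ 4 ℕ.* (suc t ℕ.* suc t))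
    bound≡ m t = sym (begin
      + (16 ℕ.* m ℕ.* M ℕ.^ 4 ℕ.* (suc t ℕ.* suc t))         ≡⟨ pos-* (16 ℕ.* m ℕ.* M ℕ.^ 4) _ ⟩
      + (16 ℕ.* m ℕ.* M ℕ.^ 4) * + (suc t ℕ.* suc t)         ≡⟨ cong₂ _*_ (pos-* (16 ℕ.* m) _) (pos-* (suc t) (suc t)) ⟩
      + (16 ℕ.* m) * + (M ℕ.^ 4) * (+ suc t * + suc t)       ≡⟨ cong (λ x → x * + (M ℕ.^ 4) * (+ suc t * + suc t)) (pos-* 16 m) ⟩
      bound m t                                              ∎)
      where open ≡-Reasoning

    advance-bound : ∀ {L} t (rows : List (Row (suc L))) → potential rows ≤ bound (length rows) t →
      potential (advance (w (nextSide rows)) rows) ≤ bound (length rows) (suc t)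
    advance-bound t rows Φ≤ = *-cancelˡ-≤-pos _ _ u (begin
      u * potential (advance a rows)
        ≤⟨ advance-≤ u a rows (+≤+ ℕ.z≤n) ⟩
      (1ℤ + u) * potential rows + + 4 * u * a * cubicMass rows + m * (c * a ^ 4)
        ≤⟨ +-mono-≤ (+-mono-≤ (*-monoˡ-≤-nonNeg (1ℤ + u) Φ≤) linear≤0)
                    (*-monoˡ-≤-nonNeg m (*-monoˡ-≤-nonNeg c {{nonNegative 0≤c}} (w^4≤M^4 b))) ⟩
      (1ℤ + u) * (+ 16 * m * M⁴ * (u * u)) + 0ℤ + m * (c * M⁴)
        ≤⟨ ≤-by-slack (+ 13 * m * M⁴ * u) 0≤slack (arithmetic u m M⁴) ⟩
      u * (+ 16 * m * M⁴ * ((1ℤ + u) * (1ℤ + u))) ∎)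
      where
      open ≤-Reasoning
      u = + suc t
      b = nextSide rows
      a = w b
      m = + length rows
      M⁴ = + (M ℕ.^ 4)
      c = u * (+ 16 * u + + 3)
      0≤c : 0ℤ ≤ c
      0≤c = 0≤i*j {u} {+ 16 * u + + 3} (+≤+ ℕ.z≤n) (+-mono-≤ (0≤i*j {+ 16} {u} (+≤+ ℕ.z≤n) (+≤+ ℕ.z≤n)) (+≤+ ℕ.z≤n))
      0≤slack : 0ℤ ≤ + 13 * m * M⁴ * u
      0≤slack = 0≤i*j {+ 13 * m * M⁴} {u}
        (0≤i*j {+ 13 * m} {M⁴} (0≤i*j {+ 13} {m} (+≤+ ℕ.z≤n) (+≤+ ℕ.z≤n)) (+≤+ ℕ.z≤n)) (+≤+ ℕ.z≤n)
      linear≤0 : + 4 * u * a * cubicMass rows ≤ 0ℤ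
      linear≤0 = begin
        + 4 * u * a * cubicMass rows   ≡⟨ *-assoc (+ 4 * u) a (cubicMass rows) ⟩
        + 4 * u * (a * cubicMass rows) ≤⟨ *-monoˡ-≤-nonNeg (+ 4 * u) (w-choose-≤0 (cubicMass rows)) ⟩
        + 4 * u * 0ℤ                   ≡⟨ *-zeroʳ (+ 4 * u) ⟩
        0ℤ                             ∎
      arithmetic : ∀ u m M⁴ →
        (1ℤ + u) * (+ 16 * m * M⁴ * (u * u)) + 0ℤ + m * (u * (+ 16 * u + + 3) * M⁴) + + 13 * m * M⁴ * u
          ≡ u * (+ 16 * m * M⁴ * ((1ℤ + u) * (1ℤ + u)))
      arithmetic = solve-∀

    value : ∀ {L} → Subset L → Row L → ℤ
    value T (D , A) = D + signedSum w A T

    value-[] : ∀ (r : Row 0) → value [] r ≡ proj₁ r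
    value-[] (D , []) = +-identityʳ D

    value-advance : ∀ {L} b (T : Subset L) r → value (b ∷ T) r ≡ value T (advanceRow (w b) r)
    value-advance b T (D , inside ∷ A)  = sym (+-assoc D (w b) (signedSum w A T))
    value-advance b T (D , outside ∷ A) = refl

    greedy-bound : ∀ {L} t (rows : List (Row L)) → potential rows ≤ bound (length rows) t →
      quarticSum (map (value (greedy rows)) rows) ≤ bound (length rows) (t ℕ.+ L)
    greedy-bound {zero} t rows Φ≤ =
      subst₂ _≤_ (cong quarticSum (sym (List.map-cong value-[] rows)))
                 (cong (bound (length rows)) (sym (ℕP.+-identityʳ t))) Φ≤
    greedy-bound {suc L} t rows Φ≤ =
      subst₂ _≤_ (cong quarticSum values≡) (cong₂ bound (List.length-map _ rows) (sym (ℕP.+-suc t L)))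
        (greedy-bound (suc t) rows′
          (subst (λ m → potential rows′ ≤ bound m (suc t)) (sym (List.length-map _ rows)) (advance-bound t rows Φ≤)))
      where
      b = nextSide rows
      rows′ = advance (w b) rows
      values≡ : map (value (greedy rows′)) rows′ ≡ map (value (b ∷ greedy rows′)) rows
      values≡ = trans (sym (List.map-∘ rows)) (List.map-cong (λ r → sym (value-advance b _ r)) rows)

    startRow : ∀ {L} → Subset L → Row L
    startRow A = 0ℤ , A

    potential-zeros : ∀ {L} (F : List (Subset L)) → potential (map startRow F) ≡ 0ℤ
    potential-zeros []      = refl
    potential-zeros (A ∷ F) = cong (_+_ (0ℤ ^ 4)) (potential-zeros F)

    balanced-subset : ∀ {L} (F : List (Subset L)) → Σ (Subset L) λ T →
      All (λ A → ∣ signedSum w A T ∣ ℕ.^ 4 ℕ.≤ 16 ℕ.* length F ℕ.* M ℕ.^ 4 ℕ.* (suc L ℕ.* suc L)) F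
    balanced-subset {L} F = T , All.map (λ {A} → toℕ {A}) each
      where
      rows = map startRow F
      T = greedy rows
      start : potential rows ≤ bound (length rows) 0
      start = subst₂ _≤_ (sym (potential-zeros F)) (sym (bound≡ (length rows) 0)) (+≤+ ℕ.z≤n)
      sum≤ : quarticSum (map (value T) rows) ≤ bound (length F) L
      sum≤ = subst (λ m → quarticSum (map (value T) rows) ≤ bound m L)
                   (List.length-map startRow F) (greedy-bound 0 rows start)
      each : All (λ A → value T (startRow A) ^ 4 ≤ bound (length F) L) F
      each = All.map⁻ {f = startRow} (All.map⁻ {f = value T} (quarticSum-≤⇒All (map (value T) rows) sum≤))
      toℕ : ∀ {A} → value T (startRow A) ^ 4 ≤ bound (length F) L →
        ∣ signedSum w A T ∣ ℕ.^ 4 ℕ.≤ 16 ℕ.* length F ℕ.* M ℕ.^ 4 ℕ.* (suc L ℕ.* suc L)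
      toℕ {A} h = drop‿+≤+ (subst₂ _≤_
        (trans (cong (_^ 4) (+-identityˡ (signedSum w A T))) (i^4≡+∣i∣^4 (signedSum w A T)))
        (bound≡ (length F) L) h)

module ProportionalSubset where

  open import Data.Nat
  open import Data.Nat.Properties
  open import Data.Nat.Tactic.RingSolver using (solve-∀)
  import Data.Integer as ℤ
  import Data.Integer.Properties as ℤP
  import Data.Integer.Tactic.RingSolver as ℤ-Ring
  open ℤ using (ℤ; +_; 0ℤ; 1ℤ)
  open import Data.Fin.Subset using (Subset; Side; inside; outside; ⊤; _∩_; _⊆_; ∣_∣)
  open import Data.Fin.Subset.Properties using (∣⊤∣≡n; ∩-identityˡ; p⊆q⇒∣p∣≤∣q∣; x∈p∩q⁺; x∈p∩q⁻)
  open import Data.Vec using ([]; _∷_; here; there)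
  open import Data.List using (List; _∷_; length)
  open import Data.List.Relation.Unary.All as All using (All)
  open import Data.Product using (Σ; _×_; _,_; proj₁; proj₂)
  open import Algebra.Properties.CommutativeSemigroup *-commutativeSemigroup using (x∙yz≈y∙xz)
  open import Relation.Binary.PropositionalEquality
  open import Relation.Nullary using (yes; no)
  open FourthMomentGreedy using (signedSum; balanced-subset)

  deviationWeight : ℕ → ℕ → Side → ℤ
  deviationWeight s r inside  = + r
  deviationWeight s r outside = ℤ.- + s

  signedSum-deviationWeight : ∀ {L} s r (A T : Subset L) →
    signedSum (deviationWeight s r) A T ≡ (+ s ℤ.+ + r) ℤ.* + ∣ A ∩ T ∣ ℤ.- + s ℤ.* + ∣ A ∣
  signedSum-deviationWeight s r []            []            = empty (+ s) (+ r)
    where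
    empty : ∀ s r → 0ℤ ≡ (s ℤ.+ r) ℤ.* 0ℤ ℤ.- s ℤ.* 0ℤ
    empty = ℤ-Ring.solve-∀
  signedSum-deviationWeight s r (inside ∷ A)  (inside ∷ T)  =
    trans (cong (ℤ._+_ (+ r)) (signedSum-deviationWeight s r A T)) (hit (+ s) (+ r) (+ ∣ A ∩ T ∣) (+ ∣ A ∣))
    where
    hit : ∀ s r c a → r ℤ.+ ((s ℤ.+ r) ℤ.* c ℤ.- s ℤ.* a) ≡ (s ℤ.+ r) ℤ.* (1ℤ ℤ.+ c) ℤ.- s ℤ.* (1ℤ ℤ.+ a)
    hit = ℤ-Ring.solve-∀
  signedSum-deviationWeight s r (inside ∷ A)  (outside ∷ T) =
    trans (cong (ℤ._+_ (ℤ.- + s)) (signedSum-deviationWeight s r A T)) (miss (+ s) (+ r) (+ ∣ A ∩ T ∣) (+ ∣ A ∣))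
    where
    miss : ∀ s r c a → ℤ.- s ℤ.+ ((s ℤ.+ r) ℤ.* c ℤ.- s ℤ.* a) ≡ (s ℤ.+ r) ℤ.* c ℤ.- s ℤ.* (1ℤ ℤ.+ a)
    miss = ℤ-Ring.solve-∀
  signedSum-deviationWeight s r (outside ∷ A) (_ ∷ T)       = signedSum-deviationWeight s r A T

  ∣m⊖n∣≡∣m-n∣ : ∀ m n → ℤ.∣ m ℤ.⊖ n ∣ ≡ ∣ m - n ∣
  ∣m⊖n∣≡∣m-n∣ zero    zero    = refl
  ∣m⊖n∣≡∣m-n∣ zero    (suc n) = refl
  ∣m⊖n∣≡∣m-n∣ (suc m) zero    = refl
  ∣m⊖n∣≡∣m-n∣ (suc m) (suc n) = trans (cong ℤ.∣_∣ (ℤP.[1+m]⊖[1+n]≡m⊖n m n)) (∣m⊖n∣≡∣m-n∣ m n)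

  ∣+m-+n∣≡∣m-n∣ : ∀ m n → ℤ.∣ + m ℤ.- + n ∣ ≡ ∣ m - n ∣
  ∣+m-+n∣≡∣m-n∣ m n = trans (cong ℤ.∣_∣ (ℤP.m-n≡m⊖n m n)) (∣m⊖n∣≡∣m-n∣ m n)

  ^-cancelˡ-≤ : ∀ n .{{_ : NonZero n}} {a b} → a ^ n ≤ b ^ n → a ≤ b
  ^-cancelˡ-≤ n h = ≮⇒≥ (λ b<a → <⇒≱ (^-monoˡ-< n b<a) h)

  fourth-root-bound : ∀ k d m N → d ^ 4 ≤ 16 * m * N ^ 4 * (suc N * suc N) →
    16 * k ^ 4 * m * (suc N * suc N) ≤ N ^ 4 → k * d ≤ N * N
  fourth-root-bound k d m N d⁴≤ small = ^-cancelˡ-≤ 4 (begin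
    (k * d) ^ 4                               ≡⟨ power-of-product k d ⟩
    k ^ 4 * d ^ 4                             ≤⟨ *-monoʳ-≤ (k ^ 4) d⁴≤ ⟩
    k ^ 4 * (16 * m * N ^ 4 * (suc N * suc N)) ≡⟨ regroup (k ^ 4) m (N ^ 4) (suc N * suc N) ⟩
    16 * k ^ 4 * m * (suc N * suc N) * N ^ 4   ≤⟨ *-monoˡ-≤ (N ^ 4) small ⟩
    N ^ 4 * N ^ 4                             ≡⟨ power-of-product N N ⟨
    (N * N) ^ 4                               ∎)
    where
    open ≤-Reasoning
    power-of-product : ∀ k d → (k * d) ^ 4 ≡ k ^ 4 * d ^ 4
    power-of-product = unfolded
      where
      unfolded : ∀ k d → k * d * (k * d * (k * d * (k * d * 1))) ≡ k * (k * (k * (k * 1))) * (d * (d * (d * (d * 1))))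
      unfolded = solve-∀
    regroup : ∀ K m N⁴ S → K * (16 * m * N⁴ * S) ≡ 16 * K * m * S * N⁴
    regroup = solve-∀

  lower-≤-deviation : ∀ k x y B → k * ∣ x - y ∣ ≤ B → k * y ≤ k * x + B
  lower-≤-deviation k x y B h = begin
    k * y               ≤⟨ *-monoʳ-≤ k (m≤n+∣n-m∣ y x) ⟩
    k * (x + ∣ x - y ∣) ≡⟨ *-distribˡ-+ k x _ ⟩
    k * x + k * ∣ x - y ∣ ≤⟨ +-monoʳ-≤ (k * x) h ⟩
    k * x + B           ∎
    where open ≤-Reasoning

  excess-≤-deviation : ∀ k x y B → k * ∣ x - y ∣ ≤ B → k * (x ∸ y) ≤ B
  excess-≤-deviation k x y B h = ≤-trans (*-monoʳ-≤ k (m∸n≤∣m-n∣ x y)) h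

  shrink : ∀ {L} → ℕ → Subset L → Subset L
  shrink zero    T             = T
  shrink (suc e) []            = []
  shrink (suc e) (inside ∷ T)  = outside ∷ shrink e T
  shrink (suc e) (outside ∷ T) = outside ∷ shrink (suc e) T

  ∣shrink∣ : ∀ {L} e (T : Subset L) → e ≤ ∣ T ∣ → ∣ shrink e T ∣ + e ≡ ∣ T ∣
  ∣shrink∣ zero    T             _         = +-identityʳ ∣ T ∣
  ∣shrink∣ (suc e) (inside ∷ T)  (s≤s e≤T) = trans (+-suc _ e) (cong suc (∣shrink∣ e T e≤T))
  ∣shrink∣ (suc e) (outside ∷ T) e≤T       = ∣shrink∣ (suc e) T e≤T

  ∣∩shrink∣ : ∀ {L} e (A T : Subset L) → ∣ A ∩ T ∣ ≤ ∣ A ∩ shrink e T ∣ + e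
  ∣∩shrink∣ zero    A             T             = m≤m+n _ 0
  ∣∩shrink∣ (suc e) []            []            = z≤n
  ∣∩shrink∣ (suc e) (inside ∷ A)  (inside ∷ T)  = ≤-trans (s≤s (∣∩shrink∣ e A T)) (≤-reflexive (sym (+-suc _ e)))
  ∣∩shrink∣ (suc e) (outside ∷ A) (inside ∷ T)  = ≤-trans (∣∩shrink∣ e A T) (+-monoʳ-≤ _ (n≤1+n e))
  ∣∩shrink∣ (suc e) (inside ∷ A)  (outside ∷ T) = ∣∩shrink∣ (suc e) A T
  ∣∩shrink∣ (suc e) (outside ∷ A) (outside ∷ T) = ∣∩shrink∣ (suc e) A T

  grow : ∀ {L} → ℕ → Subset L → Subset L
  grow zero    T             = T
  grow (suc e) []            = []
  grow (suc e) (inside ∷ T)  = inside ∷ grow (suc e) T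
  grow (suc e) (outside ∷ T) = inside ∷ grow e T

  ∣grow∣ : ∀ {L} e (T : Subset L) → ∣ T ∣ + e ≤ L → ∣ grow e T ∣ ≡ ∣ T ∣ + e
  ∣grow∣ zero    T             _   = sym (+-identityʳ ∣ T ∣)
  ∣grow∣ (suc e) (inside ∷ T)  (s≤s h) = cong suc (∣grow∣ (suc e) T h)
  ∣grow∣ (suc e) (outside ∷ T) h   =
    trans (cong suc (∣grow∣ e T (≤-pred (≤-trans (≤-reflexive (sym (+-suc ∣ T ∣ e))) h)))) (sym (+-suc ∣ T ∣ e))

  ⊆-grow : ∀ {L} e (T : Subset L) → T ⊆ grow e T
  ⊆-grow zero    T             x∈T         = x∈T
  ⊆-grow (suc e) (inside ∷ T)  here        = here
  ⊆-grow (suc e) (inside ∷ T)  (there x∈T) = there (⊆-grow (suc e) T x∈T)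
  ⊆-grow (suc e) (outside ∷ T) (there x∈T) = there (⊆-grow e T x∈T)

  ∣∩∣-monoʳ : ∀ {L} (A : Subset L) {T T′} → T ⊆ T′ → ∣ A ∩ T ∣ ≤ ∣ A ∩ T′ ∣
  ∣∩∣-monoʳ A {T} T⊆T′ = p⊆q⇒∣p∣≤∣q∣ λ x∈A∩T →
    let (x∈A , x∈T) = x∈p∩q⁻ A T x∈A∩T in x∈p∩q⁺ (x∈A , T⊆T′ x∈T)

  resize : ∀ {L} (T : Subset L) s → s ≤ L →
    Σ (Subset L) λ T′ → ∣ T′ ∣ ≡ s × (∀ A → ∣ A ∩ T ∣ ≤ ∣ A ∩ T′ ∣ + (∣ T ∣ ∸ s))
  resize T s s≤L with s ≤? ∣ T ∣
  ... | yes s≤T = shrink e T , +-cancelʳ-≡ e _ s size , λ A → ∣∩shrink∣ e A T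
    where
    e = ∣ T ∣ ∸ s
    size : ∣ shrink e T ∣ + e ≡ s + e
    size = trans (∣shrink∣ e T (m∸n≤m ∣ T ∣ s)) (sym (m+[n∸m]≡n s≤T))
  ... | no  s≰T = grow e T , size , λ A → ≤-trans (∣∩∣-monoʳ A (⊆-grow e T)) (m≤m+n _ _)
    where
    e = s ∸ ∣ T ∣
    T+e≡s : ∣ T ∣ + e ≡ s
    T+e≡s = m+[n∸m]≡n (<⇒≤ (≰⇒> s≰T))
    size : ∣ grow e T ∣ ≡ s
    size = trans (∣grow∣ e T (≤-trans (≤-reflexive T+e≡s) s≤L)) T+e≡s

  ∣signedSum-deviationWeight∣ : ∀ {N} s (A T : Subset N) → s ≤ N →
    ℤ.∣ signedSum (deviationWeight s (N ∸ s)) A T ∣ ≡ ∣ N * ∣ A ∩ T ∣ - s * ∣ A ∣ ∣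
  ∣signedSum-deviationWeight∣ {N} s A T s≤N = trans (cong ℤ.∣_∣ (begin
    signedSum (deviationWeight s (N ∸ s)) A T          ≡⟨ signedSum-deviationWeight s (N ∸ s) A T ⟩
    + (s + (N ∸ s)) ℤ.* + ∣ A ∩ T ∣ ℤ.- + s ℤ.* + ∣ A ∣ ≡⟨ cong₂ ℤ._-_ (cong (λ n → + n ℤ.* + ∣ A ∩ T ∣) (m+[n∸m]≡n s≤N))
                                                                  (sym (ℤP.pos-* s ∣ A ∣)) ⟩
    + N ℤ.* + ∣ A ∩ T ∣ ℤ.- + (s * ∣ A ∣)               ≡⟨ cong (ℤ._- + (s * ∣ A ∣)) (sym (ℤP.pos-* N ∣ A ∩ T ∣)) ⟩
    + (N * ∣ A ∩ T ∣) ℤ.- + (s * ∣ A ∣)                 ∎)) (∣+m-+n∣≡∣m-n∣ (N * ∣ A ∩ T ∣) (s * ∣ A ∣))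
    where open ≡-Reasoning

  deviation-balanced-subset : ∀ {N} s k (F : List (Subset N)) → s ≤ N →
    16 * k ^ 4 * length F * (suc N * suc N) ≤ N ^ 4 →
    Σ (Subset N) λ T → All (λ A → k * ∣ N * ∣ A ∩ T ∣ - s * ∣ A ∣ ∣ ≤ N * N) F
  deviation-balanced-subset {N} s k F s≤N small = T , All.map (λ {A} → scaled {A}) (proj₂ choice)
    where
    w = deviationWeight s (N ∸ s)
    ∣w∣≤N : ∀ b → ℤ.∣ w b ∣ ≤ N
    ∣w∣≤N inside  = m∸n≤m N s
    ∣w∣≤N outside = ≤-trans (≤-reflexive (ℤP.∣-i∣≡∣i∣ (+ s))) s≤N
    choice = balanced-subset w (ℤP.neg-mono-≤ (ℤ.+≤+ z≤n)) (ℤ.+≤+ z≤n) N ∣w∣≤N F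
    T = proj₁ choice
    scaled : ∀ {A} → ℤ.∣ signedSum w A T ∣ ^ 4 ≤ 16 * length F * N ^ 4 * (suc N * suc N) →
      k * ∣ N * ∣ A ∩ T ∣ - s * ∣ A ∣ ∣ ≤ N * N
    scaled {A} h = fourth-root-bound k _ (length F) N
      (subst (λ x → x ^ 4 ≤ _) (∣signedSum-deviationWeight∣ s A T s≤N) h) small

  excess-≤ : ∀ {N} .{{_ : NonZero N}} s k (T : Subset N) →
    k * ∣ N * ∣ ⊤ ∩ T ∣ - s * ∣ ⊤ {N} ∣ ∣ ≤ N * N → k * (∣ T ∣ ∸ s) ≤ N
  excess-≤ {N} s k T h = *-cancelˡ-≤ N (subst (_≤ N * N) excess≡ (excess-≤-deviation k (N * ∣ ⊤ ∩ T ∣) (s * ∣ ⊤ {N} ∣) (N * N) h))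
    where
    excess≡ : k * (N * ∣ ⊤ ∩ T ∣ ∸ s * ∣ ⊤ {N} ∣) ≡ N * (k * (∣ T ∣ ∸ s))
    excess≡ = begin
      k * (N * ∣ ⊤ ∩ T ∣ ∸ s * ∣ ⊤ {N} ∣) ≡⟨ cong₂ (λ a b → k * (N * a ∸ s * b)) (cong ∣_∣ (∩-identityˡ T)) (∣⊤∣≡n N) ⟩
      k * (N * ∣ T ∣ ∸ s * N)             ≡⟨ cong (λ x → k * (N * ∣ T ∣ ∸ x)) (*-comm s N) ⟩
      k * (N * ∣ T ∣ ∸ N * s)             ≡⟨ cong (k *_) (sym (*-distribˡ-∸ N ∣ T ∣ s)) ⟩
      k * (N * (∣ T ∣ ∸ s))               ≡⟨ x∙yz≈y∙xz k N (∣ T ∣ ∸ s) ⟩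
      N * (k * (∣ T ∣ ∸ s))               ∎
      where open ≡-Reasoning

  -- Balancing against the whole ground set as well pins down ∣ T₀ ∣ ≈ s, so
  -- resizing T₀ to exactly s points costs little.
  proportional-subset : ∀ {N} .{{_ : NonZero N}} s k (F : List (Subset N)) → s ≤ N →
    16 * k ^ 4 * suc (length F) * (suc N * suc N) ≤ N ^ 4 →
    Σ (Subset N) λ T → ∣ T ∣ ≡ s × All (λ A → k * (s * ∣ A ∣) ≤ k * (N * ∣ A ∩ T ∣) + 2 * (N * N)) F
  proportional-subset {N} s k F s≤N small =
    T , proj₁ (proj₂ resized) , All.map (λ {A} → proportional {A}) (All.tail (proj₂ balanced))
    where
    balanced = deviation-balanced-subset s k (⊤ ∷ F) s≤N small
    T₀ = proj₁ balanced
    e = ∣ T₀ ∣ ∸ s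
    ke≤N : k * e ≤ N
    ke≤N = excess-≤ s k T₀ (All.head (proj₂ balanced))
    resized = resize T₀ s s≤N
    T = proj₁ resized
    proportional : ∀ {A} → k * ∣ N * ∣ A ∩ T₀ ∣ - s * ∣ A ∣ ∣ ≤ N * N →
      k * (s * ∣ A ∣) ≤ k * (N * ∣ A ∩ T ∣) + 2 * (N * N)
    proportional {A} h = begin
      k * (s * ∣ A ∣)                          ≤⟨ lower-≤-deviation k _ _ (N * N) h ⟩
      k * (N * ∣ A ∩ T₀ ∣) + N * N              ≤⟨ +-monoˡ-≤ (N * N) (*-monoʳ-≤ k (*-monoʳ-≤ N (proj₂ (proj₂ resized) A))) ⟩
      k * (N * (∣ A ∩ T ∣ + e)) + N * N         ≡⟨ expand k N ∣ A ∩ T ∣ e (N * N) ⟩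
      k * (N * ∣ A ∩ T ∣) + N * (k * e) + N * N ≤⟨ +-monoˡ-≤ (N * N) (+-monoʳ-≤ _ (*-monoʳ-≤ N ke≤N)) ⟩
      k * (N * ∣ A ∩ T ∣) + N * N + N * N       ≡⟨ collect (k * (N * ∣ A ∩ T ∣)) (N * N) ⟩
      k * (N * ∣ A ∩ T ∣) + 2 * (N * N)         ∎
      where
      open ≤-Reasoning
      expand : ∀ k N c e B → k * (N * (c + e)) + B ≡ k * (N * c) + N * (k * e) + B
      expand = solve-∀
      collect : ∀ x B → x + B + B ≡ x + 2 * B
      collect = solve-∀

module BlowUp where

  open import Defs hiding (sym)
  open import Data.Nat using (zero; suc; _+_; _*_)
  open import Data.Bool using (true)
  open import Data.Fin using (Fin; zero; suc)
  open import Data.Fin.Properties using (any?; _≟_)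
  open import Data.Fin.Subset using (Subset; inside; outside; _∈_; _⊆_; _∩_; ∣_∣)
  open import Data.Fin.Subset.Properties using (_∈?_; ∈⊤)
  open import Data.Vec using (Vec; []; _∷_; _++_; map; lookup; tabulate; allFin)
  open import Data.Vec.Properties
    using (tabulate-∘; tabulate∘lookup; lookup∘tabulate; map-cong; map-∘; map-++; map-lookup-allFin;
           lookup-map; []=⇒lookup; lookup⇒[]=)
  open import Data.Product using (∃; _×_; _,_; proj₁; proj₂)
  open import Function using (_∘_)
  open import Relation.Binary.PropositionalEquality
  open import Relation.Nullary using (Dec; does; yes; no)
  open import Relation.Nullary.Decidable using (_×-dec_; dec-true)

  blowUp : ∀ {N n} → Graph N → Vec (Fin N) n → Graph n
  blowUp G π = record
    { adj    = λ a b → adj G (lookup π a) (lookup π b)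
    ; sym    = λ a b → Graph.sym G (lookup π a) (lookup π b)
    ; irrefl = λ a → irrefl G (lookup π a)
    }

  neighbours : ∀ {N} → Graph N → Fin N → Subset N
  neighbours G u = tabulate (adj G u)

  preimage : ∀ {N n} → Vec (Fin N) n → Subset N → Subset n
  preimage π P = map (lookup P) π

  degree-blowUp : ∀ {N n} (G : Graph N) (π : Vec (Fin N) n) a →
    degree (blowUp G π) a ≡ ∣ preimage π (neighbours G (lookup π a)) ∣
  degree-blowUp G π a = cong ∣_∣ (begin
    tabulate (adj G u ∘ lookup π)         ≡⟨ tabulate-∘ (adj G u) (lookup π) ⟩
    map (adj G u) (tabulate (lookup π))   ≡⟨ cong (map (adj G u)) (tabulate∘lookup π) ⟩
    map (adj G u) π                       ≡⟨ map-cong (λ v → sym (lookup∘tabulate (adj G u) v)) π ⟩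
    map (lookup (neighbours G u)) π       ∎)
    where
    open ≡-Reasoning
    u = lookup π a

  hasClique-blowUp : ∀ {N n r} (G : Graph N) (π : Vec (Fin N) n) → HasClique (blowUp G π) r → HasClique G r
  hasClique-blowUp G π (f , _ , adjacent) = lookup π ∘ f , (λ _ → ∈⊤) , adjacent

  module _ {N n} (π : Vec (Fin N) n) (S : Subset n) where

    occupied? : ∀ u → Dec (∃ λ b → b ∈ S × lookup π b ≡ u)
    occupied? u = any? λ b → (b ∈? S) ×-dec (lookup π b ≟ u)

    image : Subset N
    image = tabulate λ u → does (occupied? u)

    ∈-image⁺ : ∀ {b} → b ∈ S → lookup π b ∈ image
    ∈-image⁺ {b} b∈S = lookup⇒[]= u image
      (trans (lookup∘tabulate _ u) (dec-true (occupied? u) (b , b∈S , refl)))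
      where u = lookup π b

    ∈-image⁻ : ∀ {u} → u ∈ image → ∃ λ b → b ∈ S × lookup π b ≡ u
    ∈-image⁻ {u} u∈image =
      witness (occupied? u) (trans (sym (lookup∘tabulate _ u)) ([]=⇒lookup u∈image))
      where
      witness : ∀ {A : Set} (a? : Dec A) → does a? ≡ true → A
      witness (yes a) _  = a
      witness (no _)  ()

    ⊆-preimage-image : S ⊆ preimage π image
    ⊆-preimage-image {b} b∈S =
      lookup⇒[]= b _ (trans (lookup-map b (lookup image) π) ([]=⇒lookup (∈-image⁺ b∈S)))

    cliqueIn-image : ∀ {ℓ} (G : Graph N) → CliqueIn G ℓ image → CliqueIn (blowUp G π) ℓ S
    cliqueIn-image G (g , g∈ , g-adjacent) = proj₁ ∘ lift , (proj₁ ∘ proj₂ ∘ lift) , adjacent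
      where
      lift = λ i → ∈-image⁻ (g∈ i)
      adjacent = λ i j i≢j → subst₂ (λ x y → adj G x y ≡ _)
        (sym (proj₂ (proj₂ (lift i)))) (sym (proj₂ (proj₂ (lift j)))) (g-adjacent i j i≢j)

  ∣++∣ : ∀ {m n} (p : Subset m) (q : Subset n) → ∣ p ++ q ∣ ≡ ∣ p ∣ + ∣ q ∣
  ∣++∣ []            q = refl
  ∣++∣ (inside ∷ p)  q = cong suc (∣++∣ p q)
  ∣++∣ (outside ∷ p) q = ∣++∣ p q

  copies : ∀ {N} q → Vec (Fin N) (q * N)
  copies         zero    = []
  copies {N = N} (suc q) = allFin N ++ copies q

  elements : ∀ {N} (T : Subset N) → Vec (Fin N) ∣ T ∣
  elements []            = []
  elements (inside ∷ T)  = zero ∷ map suc (elements T)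
  elements (outside ∷ T) = map suc (elements T)

  ∣preimage-copies∣ : ∀ {N} q (A : Subset N) → ∣ preimage (copies q) A ∣ ≡ q * ∣ A ∣
  ∣preimage-copies∣         zero    A = refl
  ∣preimage-copies∣ {N = N} (suc q) A = begin
    ∣ map (lookup A) (allFin N ++ copies q) ∣                  ≡⟨ cong ∣_∣ (map-++ (lookup A) (allFin N) (copies q)) ⟩
    ∣ map (lookup A) (allFin N) ++ preimage (copies q) A ∣     ≡⟨ ∣++∣ (map (lookup A) (allFin N)) _ ⟩
    ∣ map (lookup A) (allFin N) ∣ + ∣ preimage (copies q) A ∣  ≡⟨ cong₂ _+_ (cong ∣_∣ (map-lookup-allFin A))
                                                                          (∣preimage-copies∣ q A) ⟩
    ∣ A ∣ + q * ∣ A ∣                                          ∎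
    where open ≡-Reasoning

  ∣preimage-shifted∣ : ∀ {N} (T : Subset N) x A → ∣ preimage (map suc (elements T)) (x ∷ A) ∣ ≡ ∣ A ∩ T ∣

  ∣preimage-elements∣ : ∀ {N} (T A : Subset N) → ∣ preimage (elements T) A ∣ ≡ ∣ A ∩ T ∣
  ∣preimage-elements∣ []            []            = refl
  ∣preimage-elements∣ (inside ∷ T)  (inside ∷ A)  = cong suc (∣preimage-shifted∣ T inside A)
  ∣preimage-elements∣ (inside ∷ T)  (outside ∷ A) = ∣preimage-shifted∣ T outside A
  ∣preimage-elements∣ (outside ∷ T) (inside ∷ A)  = ∣preimage-shifted∣ T inside A
  ∣preimage-elements∣ (outside ∷ T) (outside ∷ A) = ∣preimage-shifted∣ T outside A

  ∣preimage-shifted∣ T x A = trans (cong ∣_∣ (sym (map-∘ (lookup (x ∷ A)) suc (elements T)))) (∣preimage-elements∣ T A)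

  labelling : ∀ {N n} q (T : Subset N) → n ≡ q * N + ∣ T ∣ → Vec (Fin N) n
  labelling q T refl = copies q ++ elements T

  ∣preimage-labelling∣ : ∀ {N n} q (T : Subset N) (n≡ : n ≡ q * N + ∣ T ∣) A →
    ∣ preimage (labelling q T n≡) A ∣ ≡ q * ∣ A ∣ + ∣ A ∩ T ∣
  ∣preimage-labelling∣ q T refl A = begin
    ∣ map (lookup A) (copies q ++ elements T) ∣                          ≡⟨ cong ∣_∣ (map-++ (lookup A) (copies q) (elements T)) ⟩
    ∣ preimage (copies q) A ++ preimage (elements T) A ∣                 ≡⟨ ∣++∣ (preimage (copies q) A) _ ⟩
    ∣ preimage (copies q) A ∣ + ∣ preimage (elements T) A ∣              ≡⟨ cong₂ _+_ (∣preimage-copies∣ q A) (∣preimage-elements∣ T A) ⟩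
    q * ∣ A ∣ + ∣ A ∩ T ∣                                                ∎
    where open ≡-Reasoning

module RationalBounds where

  open import Defs using (ℕ→ℚ; frac)
  open import Data.Nat as ℕ using (suc)
  open import Data.Integer as ℤ using (ℤ; +_; +[1+_])
  import Data.Integer.Properties as ℤP
  import Data.Integer.Tactic.RingSolver as ℤ-Ring
  open import Data.Rational as ℚ using (mkℚ; Positive; toℚᵘ)
  import Data.Rational.Properties as ℚP
  open import Data.Rational.Unnormalised as ℚᵘ using (mkℚᵘ; *≡*; *≤*)
  import Data.Rational.Unnormalised.Properties as ℚᵘP
  open import Algebra.Bundles using (CommutativeMonoid)
  open import Algebra.Properties.CommutativeSemigroup
    (CommutativeMonoid.commutativeSemigroup ℚP.*-1-commutativeMonoid) using (x∙yz≈y∙xz; x∙yz≈yx∙z)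
  open import Relation.Binary.PropositionalEquality
  open IntegerLemmas using (≤-by-slack; 0≤i*j)

  toℚᵘ-frac : ∀ a m → toℚᵘ (frac a (suc m)) ℚᵘ.≃ mkℚᵘ (+ a) m
  toℚᵘ-frac a m = ℚP.toℚᵘ-fromℚᵘ (mkℚᵘ (+ a) m)

  ℕ→ℚ-mono-≤ : ∀ {a b} → a ℕ.≤ b → ℕ→ℚ a ℚ.≤ ℕ→ℚ b
  ℕ→ℚ-mono-≤ {a} {b} a≤b = ℚP.toℚᵘ-cancel-≤
    (ℚᵘP.≤-respˡ-≃ (ℚᵘP.≃-sym (toℚᵘ-frac a 0)) (ℚᵘP.≤-respʳ-≃ (ℚᵘP.≃-sym (toℚᵘ-frac b 0))
      (*≤* (ℤP.*-monoʳ-≤-nonNeg ℤ.1ℤ (ℤ.+≤+ a≤b)))))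

  ℕ→ℚ-homo-* : ∀ a b → ℕ→ℚ (a ℕ.* b) ≡ ℕ→ℚ a ℚ.* ℕ→ℚ b
  ℕ→ℚ-homo-* a b = ℚP.toℚᵘ-injective (begin
    toℚᵘ (ℕ→ℚ (a ℕ.* b))                 ≈⟨ toℚᵘ-frac (a ℕ.* b) 0 ⟩
    mkℚᵘ (+ (a ℕ.* b)) 0                 ≈⟨ *≡* (cong (ℤ._* ℤ.1ℤ) (ℤP.pos-* a b)) ⟩
    mkℚᵘ (+ a) 0 ℚᵘ.* mkℚᵘ (+ b) 0       ≈⟨ ℚᵘP.*-cong (toℚᵘ-frac a 0) (toℚᵘ-frac b 0) ⟨
    toℚᵘ (ℕ→ℚ a) ℚᵘ.* toℚᵘ (ℕ→ℚ b)       ≈⟨ ℚP.toℚᵘ-homo-* (ℕ→ℚ a) (ℕ→ℚ b) ⟨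
    toℚᵘ (ℕ→ℚ a ℚ.* ℕ→ℚ b)               ∎)
    where open ℚᵘP.≃-Reasoning

  scale-≤ : ∀ α → Positive α → ∀ {x y m N n} →
    ℕ→ℚ y ℚ.≤ α ℚ.* ℕ→ℚ N → x ℕ.≤ m ℕ.* y → m ℕ.* N ℕ.≤ 2 ℕ.* n →
    ℕ→ℚ x ℚ.≤ (ℕ→ℚ 2 ℚ.* α) ℚ.* ℕ→ℚ n
  scale-≤ α α>0 {x} {y} {m} {N} {n} y≤αN x≤my mN≤2n = begin
    ℕ→ℚ x                          ≤⟨ ℕ→ℚ-mono-≤ x≤my ⟩
    ℕ→ℚ (m ℕ.* y)                  ≡⟨ ℕ→ℚ-homo-* m y ⟩
    ℕ→ℚ m ℚ.* ℕ→ℚ y                ≤⟨ ℚP.*-monoˡ-≤-nonNeg (ℕ→ℚ m) {{ℚP.normalize-nonNeg m 1}} y≤αN ⟩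
    ℕ→ℚ m ℚ.* (α ℚ.* ℕ→ℚ N)        ≡⟨ x∙yz≈y∙xz (ℕ→ℚ m) α (ℕ→ℚ N) ⟩
    α ℚ.* (ℕ→ℚ m ℚ.* ℕ→ℚ N)        ≡⟨ cong (α ℚ.*_) (ℕ→ℚ-homo-* m N) ⟨
    α ℚ.* ℕ→ℚ (m ℕ.* N)            ≤⟨ ℚP.*-monoˡ-≤-nonNeg α {{ℚP.pos⇒nonNeg α {{α>0}}}} (ℕ→ℚ-mono-≤ mN≤2n) ⟩
    α ℚ.* ℕ→ℚ (2 ℕ.* n)            ≡⟨ cong (α ℚ.*_) (ℕ→ℚ-homo-* 2 n) ⟩
    α ℚ.* (ℕ→ℚ 2 ℚ.* ℕ→ℚ n)        ≡⟨ x∙yz≈yx∙z α (ℕ→ℚ 2) (ℕ→ℚ n) ⟩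
    (ℕ→ℚ 2 ℚ.* α) ℚ.* ℕ→ℚ n        ∎
    where open ℚP.≤-Reasoning

  frac-sub-≤ : ∀ {a b N n} ε → Positive ε →
    ℚ.↧ₙ ε ℕ.* suc n ℕ.* a ℕ.≤ ℚ.↧ₙ ε ℕ.* suc N ℕ.* b ℕ.+ suc N ℕ.* suc n →
    frac a (suc N) ℚ.- ε ℚ.≤ frac b (suc n)
  frac-sub-≤ {a} {b} {N} {n} ε@(mkℚ +[1+ e ] d _) _ h = ℚP.toℚᵘ-cancel-≤ (begin
    toℚᵘ (frac a (suc N) ℚ.- ε)                 ≃⟨ ℚP.toℚᵘ-homo-+ (frac a (suc N)) (ℚ.- ε) ⟩
    toℚᵘ (frac a (suc N)) ℚᵘ.+ toℚᵘ (ℚ.- ε)     ≃⟨ ℚᵘP.+-cong (toℚᵘ-frac a N) (ℚP.toℚᵘ-homo‿- ε) ⟩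
    mkℚᵘ (+ a) N ℚᵘ.- mkℚᵘ +[1+ e ] d           ≤⟨ *≤* cross ⟩
    mkℚᵘ (+ b) n                                ≃⟨ toℚᵘ-frac b n ⟨
    toℚᵘ (frac b (suc n))                       ∎)
    where
    open ℚᵘP.≤-Reasoning
    A B C P Q E : ℤ
    A = + a
    B = + b
    C = + suc d
    P = + suc N
    Q = + suc n
    E = + e
    hyp : C ℤ.* Q ℤ.* A ℤ.≤ C ℤ.* P ℤ.* B ℤ.+ P ℤ.* Q
    hyp = subst₂ ℤ._≤_ (pos-*³ (suc d) (suc n) a)
            (trans (ℤP.pos-+ (suc d ℕ.* suc N ℕ.* b) _) (cong₂ ℤ._+_ (pos-*³ (suc d) (suc N) b) (ℤP.pos-* (suc N) (suc n))))
            (ℤ.+≤+ h)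
      where
      pos-*³ : ∀ x y z → + (x ℕ.* y ℕ.* z) ≡ + x ℤ.* + y ℤ.* + z
      pos-*³ x y z = trans (ℤP.pos-* (x ℕ.* y) z) (cong (ℤ._* + z) (ℤP.pos-* x y))
    cross : (A ℤ.* C ℤ.+ ℤ.- (ℤ.1ℤ ℤ.+ E) ℤ.* P) ℤ.* Q ℤ.≤ B ℤ.* (P ℤ.* C)
    cross = ≤-by-slack _ (ℤP.+-mono-≤ (ℤP.i≤j⇒0≤j-i hyp) (0≤i*j {E ℤ.* P} {Q} (0≤i*j {E} {P} (ℤ.+≤+ ℕ.z≤n) (ℤ.+≤+ ℕ.z≤n)) (ℤ.+≤+ ℕ.z≤n)))
              (identity A B C P Q E)
      where
      identity : ∀ A B C P Q E →
        (A ℤ.* C ℤ.+ ℤ.- (ℤ.1ℤ ℤ.+ E) ℤ.* P) ℤ.* Q ℤ.+ ((C ℤ.* P ℤ.* B ℤ.+ P ℤ.* Q ℤ.- C ℤ.* Q ℤ.* A) ℤ.+ E ℤ.* P ℤ.* Q)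
          ≡ B ℤ.* (P ℤ.* C)
      identity = ℤ-Ring.solve-∀

module RTStar where

  open import Defs hiding (sym)
  open import Data.Nat
  open import Data.Nat.Properties
  open import Data.Nat.DivMod using (m≡m%n+[m/n]*n; m%n<n; m/n*n≤m)
  open import Data.Nat.Tactic.RingSolver using (solve-∀)
  open import Data.Fin.Subset using (_∩_; ∣_∣)
  open import Data.Fin.Subset.Properties using (p⊆q⇒∣p∣≤∣q∣; ∣p∩q∣≤∣p∣)
  open import Data.Vec using (lookup)
  import Data.List as List
  import Data.List.Properties as List
  import Data.List.Relation.Unary.All.Properties as All
  open import Data.Product using (_,_; proj₁; proj₂)
  open import Data.Rational as ℚ using (Positive)
  open import Function using (_∘_)
  open import Relation.Binary.PropositionalEquality
  open BlowUp
  open ProportionalSubset using (proportional-subset)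
  open RationalBounds using (scale-≤)

  blowUp-degree-≥ : ∀ k N n q s δ D d c .{{_ : NonZero (k * N)}} →
    k * N * δ + 2 * (N * N) ≤ k * n * D → D ≤ d → n ≡ q * N + s →
    k * (s * d) ≤ k * (N * c) + 2 * (N * N) → δ ≤ q * d + c
  blowUp-degree-≥ k N n q s δ D d c hD D≤d refl hs = *-cancelˡ-≤ (k * N) (+-cancelʳ-≤ (2 * (N * N)) _ _ (begin
    k * N * δ + 2 * (N * N)                       ≤⟨ hD ⟩
    k * (q * N + s) * D                           ≤⟨ *-monoʳ-≤ (k * (q * N + s)) D≤d ⟩
    k * (q * N + s) * d                           ≡⟨ expand k N q s d ⟩
    k * N * (q * d) + k * (s * d)                 ≤⟨ +-monoʳ-≤ (k * N * (q * d)) hs ⟩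
    k * N * (q * d) + (k * (N * c) + 2 * (N * N)) ≡⟨ regroup k N q d c (2 * (N * N)) ⟩
    k * N * (q * d + c) + 2 * (N * N)             ∎))
    where
    open ≤-Reasoning
    expand : ∀ k N q s d → k * (q * N + s) * d ≡ k * N * (q * d) + k * (s * d)
    expand = solve-∀
    regroup : ∀ k N q d c B → k * N * (q * d) + (k * (N * c) + B) ≡ k * N * (q * d + c) + B
    regroup = solve-∀

  RTProp-transfer : ∀ {ℓ r N n q s k δ D} .{{_ : NonZero N}} .{{_ : NonZero k}} α → Positive α →
    s ≤ N → n ≡ q * N + s → suc q * N ≤ 2 * n →
    16 * k ^ 4 * suc N * (suc N * suc N) ≤ N ^ 4 →
    k * N * δ + 2 * (N * N) ≤ k * n * D →
    RTProp ℓ n r (ℕ→ℚ 2 ℚ.* α) δ → RTProp ℓ N r α D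
  RTProp-transfer {ℓ} {r} {N} {n} {q} {s} {k} {δ} {D} α α>0 s≤N n≡ [1+q]N≤2n small hD rtₙ G δG≥D αG =
    hasClique-blowUp G π (rtₙ (blowUp G π) δH≥δ αH)
    where
    instance
      kN≢0 : NonZero (k * N)
      kN≢0 = m*n≢0 k N
    F = List.tabulate (neighbours G)
    small′ : 16 * k ^ 4 * suc (List.length F) * (suc N * suc N) ≤ N ^ 4
    small′ = subst (λ m → 16 * k ^ 4 * suc m * (suc N * suc N) ≤ N ^ 4) (sym (List.length-tabulate _)) small
    chosen = proportional-subset s k F s≤N small′
    T = proj₁ chosen
    n≡qN+∣T∣ : n ≡ q * N + ∣ T ∣
    n≡qN+∣T∣ = trans n≡ (cong (q * N +_) (sym (proj₁ (proj₂ chosen))))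
    π = labelling q T n≡qN+∣T∣
    δH≥δ : MinDegree≥ (blowUp G π) δ
    δH≥δ a = subst (δ ≤_) (sym (trans (degree-blowUp G π a) (∣preimage-labelling∣ q T n≡qN+∣T∣ (neighbours G u))))
      (blowUp-degree-≥ k N n q s δ D (degree G u) ∣ neighbours G u ∩ T ∣ hD (δG≥D u) n≡ (All.tabulate⁻ (proj₂ (proj₂ chosen)) u))
      where u = lookup π a
    αH : αℓ≤ ℓ (blowUp G π) ((ℕ→ℚ 2 ℚ.* α) ℚ.* ℕ→ℚ n)
    αH S K-free = scale-≤ α α>0 {∣ S ∣} {∣ P ∣} {suc q} {N} {n} (αG P (K-free ∘ cliqueIn-image π S G)) ∣S∣≤ [1+q]N≤2n
      where
      P = image π S
      ∣S∣≤ : ∣ S ∣ ≤ suc q * ∣ P ∣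
      ∣S∣≤ = begin
        ∣ S ∣                   ≤⟨ p⊆q⇒∣p∣≤∣q∣ (⊆-preimage-image π S) ⟩
        ∣ preimage π P ∣        ≡⟨ ∣preimage-labelling∣ q T n≡qN+∣T∣ P ⟩
        q * ∣ P ∣ + ∣ P ∩ T ∣   ≤⟨ +-monoʳ-≤ (q * ∣ P ∣) (∣p∩q∣≤∣p∣ P T) ⟩
        q * ∣ P ∣ + ∣ P ∣       ≡⟨ +-comm (q * ∣ P ∣) ∣ P ∣ ⟩
        suc q * ∣ P ∣           ∎
        where open ≤-Reasoning

  threshold : ℕ → ℕ
  threshold c = 4 * c + 128 * (4 * c) ^ 4

  fourth-power-room : ∀ K N → 1 ≤ N → 128 * K ≤ N → 16 * K * suc N * (suc N * suc N) ≤ N ^ 4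
  fourth-power-room K N 1≤N 128K≤N = begin
    16 * K * suc N * (suc N * suc N)              ≤⟨ *-mono-≤ (*-monoʳ-≤ (16 * K) 1+N≤2N) (*-mono-≤ 1+N≤2N 1+N≤2N) ⟩
    16 * K * (2 * N) * ((2 * N) * (2 * N))        ≡⟨ cube K N ⟩
    128 * K * (N * (N * N))                       ≤⟨ *-monoˡ-≤ (N * (N * N)) 128K≤N ⟩
    N * (N * (N * N))                             ≡⟨ ^4-unfolded N ⟩
    N ^ 4                                         ∎
    where
    open ≤-Reasoning
    1+N≤2N : suc N ≤ 2 * N
    1+N≤2N = subst (suc N ≤_) (cong (N +_) (sym (+-identityʳ N))) (+-monoˡ-≤ N 1≤N)
    cube : ∀ K N → 16 * K * (2 * N) * ((2 * N) * (2 * N)) ≡ 128 * K * (N * (N * N))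
    cube = solve-∀
    ^4-unfolded : ∀ N → N * (N * (N * N)) ≡ N * (N * (N * (N * 1)))
    ^4-unfolded = solve-∀

  m≤n*[1+m/n] : ∀ m n .{{_ : NonZero n}} → m ≤ n * suc (m / n)
  m≤n*[1+m/n] m n = begin
    m                 ≡⟨ m≡m%n+[m/n]*n m n ⟩
    m % n + m / n * n ≤⟨ +-monoˡ-≤ (m / n * n) (<⇒≤ (m%n<n m n)) ⟩
    n + m / n * n     ≡⟨ cong (n +_) (*-comm (m / n) n) ⟩
    n + n * (m / n)   ≡⟨ *-suc n (m / n) ⟨
    n * suc (m / n)   ∎
    where open ≤-Reasoning

  n*[1+m/n]≤n+m : ∀ m n .{{_ : NonZero n}} → n * suc (m / n) ≤ n + m
  n*[1+m/n]≤n+m m n = begin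
    n * suc (m / n) ≡⟨ *-suc n (m / n) ⟩
    n + n * (m / n) ≡⟨ cong (n +_) (*-comm n (m / n)) ⟩
    n + m / n * n   ≤⟨ +-monoʳ-≤ n (m/n*n≤m m n) ⟩
    n + m           ∎
    where open ≤-Reasoning

  RT*-ratio : ∀ {ℓ r N n δ′ δ} c .{{_ : NonZero c}} α → Positive α →
    threshold c ≤ N → N < n →
    IsRT* ℓ N r α δ′ → IsRT* ℓ n r (ℕ→ℚ 2 ℚ.* α) δ →
    c * n * δ′ ≤ c * N * δ + N * n
  RT*-ratio {ℓ} {r} {N} {n} {δ′} {δ} c α α>0 n₀≤N N<n (_ , minimal) (rtₙ , _) = *-cancelˡ-≤ 4 (begin
    4 * (c * n * δ′)                          ≡⟨ scale c n δ′ ⟩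
    k * n * δ′                                ≤⟨ *-monoʳ-≤ (k * n) (minimal D rt) ⟩
    k * n * D                                 ≤⟨ n*[1+m/n]≤n+m X (k * n) ⟩
    k * n + X                                 ≤⟨ +-mono-≤ (*-monoˡ-≤ n k≤N) (+-monoʳ-≤ (k * N * δ) (*-monoʳ-≤ 2 (*-monoʳ-≤ N (<⇒≤ N<n)))) ⟩
    N * n + (k * N * δ + 2 * (N * n))         ≤⟨ m≤m+n _ (N * n) ⟩
    N * n + (k * N * δ + 2 * (N * n)) + N * n ≡⟨ collect c N n δ ⟩
    4 * (c * N * δ + N * n)                   ∎)
    where
    open ≤-Reasoning
    k = 4 * c
    k≤N : k ≤ N
    k≤N = ≤-trans (m≤m+n k _) n₀≤N
    instance
      k≢0 : NonZero k
      k≢0 = m*n≢0 4 c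
      N≢0 : NonZero N
      N≢0 = >-nonZero (<-≤-trans (>-nonZero⁻¹ k) k≤N)
      n≢0 : NonZero n
      n≢0 = >-nonZero (<-trans (>-nonZero⁻¹ N) N<n)
      kn≢0 : NonZero (k * n)
      kn≢0 = m*n≢0 k n
    q = n / N
    s = n % N
    n≡ : n ≡ q * N + s
    n≡ = trans (m≡m%n+[m/n]*n n N) (+-comm s (q * N))
    [1+q]N≤2n : suc q * N ≤ 2 * n
    [1+q]N≤2n = ≤-trans (+-mono-≤ (<⇒≤ N<n) (m/n*n≤m n N)) (≤-reflexive (cong (n +_) (sym (+-identityʳ n))))
    -- D is the least integer with X < k·n·D, i.e. just above (N/n)·δ + 2N²/(kn).
    X = k * N * δ + 2 * (N * N)
    D = suc (X / (k * n))
    rt : RTProp ℓ N r α D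
    rt = RTProp-transfer {q = q} {k = k} α α>0 (<⇒≤ (m%n<n n N)) n≡ [1+q]N≤2n
           (fourth-power-room (k ^ 4) N (>-nonZero⁻¹ N) (≤-trans (m≤n+m _ k) n₀≤N))
           (m≤n*[1+m/n] X (k * n)) rtₙ
    scale : ∀ c n δ′ → 4 * (c * n * δ′) ≡ 4 * c * n * δ′
    scale = solve-∀
    collect : ∀ c N n δ → N * n + (4 * c * N * δ + 2 * (N * n)) + N * n ≡ 4 * (c * N * δ + N * n)
    collect = solve-∀

open import Defs
open import Data.Nat using (ℕ; _≤_; _<_)
open import Data.Product using (Σ)
open import Data.Rational using (ℚ; Positive; _-_; _*_)
import Data.Rational

open import Data.Nat using (suc; zero)
open import Data.Product using (_,_)
open RationalBounds using (frac-sub-≤)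
open RTStar using (threshold; RT*-ratio)

lemma7p1 : (r ℓ : ℕ) (ε α : ℚ) → Positive ε → Positive α →
    Σ ℕ λ n₀ → (n n' : ℕ) → n₀ ≤ n' → n' < n →
    (δ' δ : ℕ) → IsRT* ℓ n' r α δ' → IsRT* ℓ n r (ℕ→ℚ 2 * α) δ →
    (frac δ' n' - ε) Data.Rational.≤ frac δ n
lemma7p1 r ℓ ε α ε>0 α>0 = threshold (Data.Rational.↧ₙ ε) , bound
  where
  bound : (n n′ : ℕ) → threshold (Data.Rational.↧ₙ ε) ≤ n′ → n′ < n →
    (δ′ δ : ℕ) → IsRT* ℓ n′ r α δ′ → IsRT* ℓ n r (ℕ→ℚ 2 * α) δ →
    (frac δ′ n′ - ε) Data.Rational.≤ frac δ n
  bound n       zero    ()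
  bound zero    (suc N) _   ()
  bound (suc n) (suc N) n₀≤N N<n δ′ δ rt′ rt =
    frac-sub-≤ {δ′} {δ} {N} {n} ε ε>0 (RT*-ratio (Data.Rational.↧ₙ ε) α α>0 n₀≤N N<n rt′ rt)
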